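{- The group $H$ acts on each $\Gamma_a$ ($a\in\mathbb{Z}$) by left multiplication $x\mapsto Mx$ (elements of $\Gamma_a$ viewed as column vectors), and it acts on each $\Omega_a$ by right multiplication $x\mapsto xM$ (elements of $\Omega_a$ viewed as row vectors). In particular, $\{Mx : M\in H,\ x\in\Theta_a\}\subseteq\Gamma_a$. Moreover, if $M\in H$ then: (1) the first and third columns of $M$ belong to $\Gamma_{1}$ and the second column of $M$ belongs to $\Gamma_{ -2}$; (2) the first and third rows of $M$ belong to $\Omega_{ -2}$ and the second row of $M$ belongs to $\Omega_{1}$.
   Context: For an integer $a$, $\Gamma_a$ is the set of $(x_1,x_2,x_3)\in\mathbb{Z}^3$ with $x_1^2-2x_2^2+x_3^2=a$, and $\Omega_a$ is the set of $(x_1,x_2,x_3)\in\mathbb{Z}^3$ with $-2x_1^2+x_2^2-2x_3^2=a$. Let $B=\begin{pmatrix}3&4&0\\2&3&0\\0&0&1\end{pmatrix}$, $J=\begin{pmatrix}0&0&1\\0&1&0\\1&0&0\end{pmatrix}$, and let $H$ be the subgroup of $\mathrm{GL}_3(\mathbb{Z})$ generated by $B$ and $J$. Let $\mathcal{C}=\{x\in\mathbb{Z}^3: |x_1|\le|x_2| \text{ or } |x_1|\ge 2|x_2|\}$. Define $\Theta_a=\{x\in\Gamma_a: |x_2|\ge\max\{|x_1|,|x_3|\}\}$ if $a<0$, and $\Theta_a=\{x\in\Gamma_a: x\in\mathcal{C}\text{ and }Jx\in\mathcal{C}\}$ if $a\ge 0$. -}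

module Defs where

open import Data.Integer using (ℤ; +_; -_; _+_; _*_; _<_; _≥_; ∣_∣)
open import Data.Nat as ℕ using (ℕ)
open import Data.Product using (_×_)
open import Data.Sum using (_⊎_)
open import Relation.Binary.PropositionalEquality using (_≡_)

-- Integer vectors in ℤ³ (used both as column and as row vectors).
record V3 : Set where
  constructor v3
  field
    x₁ x₂ x₃ : ℤ
open V3 public

record M3 : Set where
  constructor m3
  field
    m₁₁ m₁₂ m₁₃ m₂₁ m₂₂ m₂₃ m₃₁ m₃₂ m₃₃ : ℤ
open M3 public

_⊗_ : M3 → M3 → M3
A ⊗ C = m3
  (m₁₁ A * m₁₁ C + m₁₂ A * m₂₁ C + m₁₃ A * m₃₁ C)
  (m₁₁ A * m₁₂ C + m₁₂ A * m₂₂ C + m₁₃ A * m₃₂ C)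
  (m₁₁ A * m₁₃ C + m₁₂ A * m₂₃ C + m₁₃ A * m₃₃ C)
  (m₂₁ A * m₁₁ C + m₂₂ A * m₂₁ C + m₂₃ A * m₃₁ C)
  (m₂₁ A * m₁₂ C + m₂₂ A * m₂₂ C + m₂₃ A * m₃₂ C)
  (m₂₁ A * m₁₃ C + m₂₂ A * m₂₃ C + m₂₃ A * m₃₃ C)
  (m₃₁ A * m₁₁ C + m₃₂ A * m₂₁ C + m₃₃ A * m₃₁ C)
  (m₃₁ A * m₁₂ C + m₃₂ A * m₂₂ C + m₃₃ A * m₃₂ C)
  (m₃₁ A * m₁₃ C + m₃₂ A * m₂₃ C + m₃₃ A * m₃₃ C)

_·_ : M3 → V3 → V3
M · x = v3
  (m₁₁ M * x₁ x + m₁₂ M * x₂ x + m₁₃ M * x₃ x)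
  (m₂₁ M * x₁ x + m₂₂ M * x₂ x + m₂₃ M * x₃ x)
  (m₃₁ M * x₁ x + m₃₂ M * x₂ x + m₃₃ M * x₃ x)

_◂_ : V3 → M3 → V3
x ◂ M = v3
  (x₁ x * m₁₁ M + x₂ x * m₂₁ M + x₃ x * m₃₁ M)
  (x₁ x * m₁₂ M + x₂ x * m₂₂ M + x₃ x * m₃₂ M)
  (x₁ x * m₁₃ M + x₂ x * m₂₃ M + x₃ x * m₃₃ M)

col₁ col₂ col₃ row₁ row₂ row₃ : M3 → V3
col₁ M = v3 (m₁₁ M) (m₂₁ M) (m₃₁ M)
col₂ M = v3 (m₁₂ M) (m₂₂ M) (m₃₂ M)
col₃ M = v3 (m₁₃ M) (m₂₃ M) (m₃₃ M)
row₁ M = v3 (m₁₁ M) (m₁₂ M) (m₁₃ M)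
row₂ M = v3 (m₂₁ M) (m₂₂ M) (m₂₃ M)
row₃ M = v3 (m₃₁ M) (m₃₂ M) (m₃₃ M)

I₃ B J : M3
I₃ = m3 (+ 1) (+ 0) (+ 0) (+ 0) (+ 1) (+ 0) (+ 0) (+ 0) (+ 1)
B  = m3 (+ 3) (+ 4) (+ 0) (+ 2) (+ 3) (+ 0) (+ 0) (+ 0) (+ 1)
J  = m3 (+ 0) (+ 0) (+ 1) (+ 0) (+ 1) (+ 0) (+ 1) (+ 0) (+ 0)

-- H = subgroup of GL₃(ℤ) generated by B and J: the smallest set of
-- matrices containing I, B, J, closed under products and under taking
-- (two-sided) inverses.
data InH : M3 → Set where
  h-id  : InH I₃
  h-B   : InH B
  h-J   : InH J
  h-mul : ∀ {M N} → InH M → InH N → InH (M ⊗ N)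
  h-inv : ∀ {M N} → InH M → M ⊗ N ≡ I₃ → N ⊗ M ≡ I₃ → InH N

InΓ : ℤ → V3 → Set
InΓ a x = x₁ x * x₁ x - (+ 2) * (x₂ x * x₂ x) + x₃ x * x₃ x ≡ a
  where open Data.Integer using (_-_)

InΩ : ℤ → V3 → Set
InΩ a x = - ((+ 2) * (x₁ x * x₁ x)) + x₂ x * x₂ x - (+ 2) * (x₃ x * x₃ x) ≡ a
  where open Data.Integer using (_-_)

InC : V3 → Set
InC x = (∣ x₁ x ∣ ℕ.≤ ∣ x₂ x ∣) ⊎ (2 ℕ.* ∣ x₂ x ∣ ℕ.≤ ∣ x₁ x ∣)

InΘ : ℤ → V3 → Set
InΘ a x =
    (a < + 0 × InΓ a x × (∣ x₁ x ∣ ℕ.⊔ ∣ x₃ x ∣) ℕ.≤ ∣ x₂ x ∣)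
  ⊎ (a ≥ + 0 × InΓ a x × InC x × InC (J · x))

module Submission where

open import Defs
open import Data.Integer using (ℤ; +_; -_; _+_; _*_; _-_)
open import Data.Integer.Tactic.RingSolver using (solve-∀)
open import Data.Product using (_×_; _,_)
open import Data.Sum using (inj₁; inj₂)
open import Relation.Binary.PropositionalEquality using (_≡_; refl; sym; trans; cong)

-- Write Q x = x₁² − 2x₂² + x₃² and D x = −2x₁² + x₂² − 2x₃², so
-- Γ_a = {Q = a} and Ω_a = {D = a}.  Both actions are expressed through the
-- bilinear pairing ⟨u , v⟩ = u₁v₁ + u₂v₂ + u₃v₃: the i-th coordinate of M x is
-- ⟨row_i M , x⟩, the j-th coordinate of x M is ⟨x , col_j M⟩, and the rows of
-- M ⊗ N are row_i M ◂ N while its columns are M · col_j N (all definitionally).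
-- Hence the action laws reduce to the adjunction ⟨u M , x⟩ = ⟨u , M x⟩ and to
-- the fact that pairing with a standard basis vector selects a coordinate.
-- Next, for any function f on ℤ³ the matrices leaving f invariant (on the left,
-- resp. on the right) contain I₃ and are closed under products and inverses;
-- so f is invariant under all of H as soon as it is invariant under B and J.
-- This applies to Q (left) and D (right) by two explicit polynomial identities
-- for B and a coordinate swap for J.  Finally M e_j = col_j M and e_i M = row_i M,
-- so columns and rows of M ∈ H carry the invariant values Q e_j and D e_i.

v3-cong : ∀ {a b c a′ b′ c′} → a ≡ a′ → b ≡ b′ → c ≡ c′ → v3 a b c ≡ v3 a′ b′ c′
v3-cong refl refl refl = refl

⟨_,_⟩ : V3 → V3 → ℤ
⟨ u , v ⟩ = x₁ u * x₁ v + x₂ u * x₂ v + x₃ u * x₃ v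

e₁ e₂ e₃ : V3
e₁ = v3 (+ 1) (+ 0) (+ 0)
e₂ = v3 (+ 0) (+ 1) (+ 0)
e₃ = v3 (+ 0) (+ 0) (+ 1)

⟨⟩-comm : ∀ u v → ⟨ u , v ⟩ ≡ ⟨ v , u ⟩
⟨⟩-comm (v3 a b c) (v3 p q r) = identity a b c p q r
  where
  identity : ∀ a b c p q r → a * p + b * q + c * r ≡ p * a + q * b + r * c
  identity = solve-∀

⟨e₁,_⟩ : ∀ v → ⟨ e₁ , v ⟩ ≡ x₁ v
⟨e₁, v3 a b c ⟩ = identity a b c
  where
  identity : ∀ a b c → + 1 * a + + 0 * b + + 0 * c ≡ a
  identity = solve-∀

⟨e₂,_⟩ : ∀ v → ⟨ e₂ , v ⟩ ≡ x₂ v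
⟨e₂, v3 a b c ⟩ = identity a b c
  where
  identity : ∀ a b c → + 0 * a + + 1 * b + + 0 * c ≡ b
  identity = solve-∀

⟨e₃,_⟩ : ∀ v → ⟨ e₃ , v ⟩ ≡ x₃ v
⟨e₃, v3 a b c ⟩ = identity a b c
  where
  identity : ∀ a b c → + 0 * a + + 0 * b + + 1 * c ≡ c
  identity = solve-∀

⟨_,e₁⟩ : ∀ u → ⟨ u , e₁ ⟩ ≡ x₁ u
⟨ u ,e₁⟩ = trans (⟨⟩-comm u e₁) ⟨e₁, u ⟩

⟨_,e₂⟩ : ∀ u → ⟨ u , e₂ ⟩ ≡ x₂ u
⟨ u ,e₂⟩ = trans (⟨⟩-comm u e₂) ⟨e₂, u ⟩

⟨_,e₃⟩ : ∀ u → ⟨ u , e₃ ⟩ ≡ x₃ u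
⟨ u ,e₃⟩ = trans (⟨⟩-comm u e₃) ⟨e₃, u ⟩

◂-adjoint : ∀ u M x → ⟨ u ◂ M , x ⟩ ≡ ⟨ u , M · x ⟩
◂-adjoint (v3 u₁ u₂ u₃) (m3 a b c d e f g h i) (v3 p q r) =
  identity u₁ u₂ u₃ a b c d e f g h i p q r
  where
  identity : ∀ u₁ u₂ u₃ a b c d e f g h i p q r →
    (u₁ * a + u₂ * d + u₃ * g) * p + (u₁ * b + u₂ * e + u₃ * h) * q
      + (u₁ * c + u₂ * f + u₃ * i) * r
    ≡ u₁ * (a * p + b * q + c * r) + u₂ * (d * p + e * q + f * r)
      + u₃ * (g * p + h * q + i * r)
  identity = solve-∀

-- Action laws: the rows of I₃ and the columns of I₃ are e₁, e₂, e₃.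
·-identity : ∀ x → I₃ · x ≡ x
·-identity x = v3-cong ⟨e₁, x ⟩ ⟨e₂, x ⟩ ⟨e₃, x ⟩

◂-identity : ∀ x → x ◂ I₃ ≡ x
◂-identity x = v3-cong ⟨ x ,e₁⟩ ⟨ x ,e₂⟩ ⟨ x ,e₃⟩

-- The rows of M ⊗ N are (row_i M) ◂ N.
·-⊗ : ∀ M N x → (M ⊗ N) · x ≡ M · (N · x)
·-⊗ M N x =
  v3-cong (◂-adjoint (row₁ M) N x) (◂-adjoint (row₂ M) N x) (◂-adjoint (row₃ M) N x)

-- The columns of M ⊗ N are M · (col_j N).
◂-⊗ : ∀ M N x → x ◂ (M ⊗ N) ≡ (x ◂ M) ◂ N
◂-⊗ M N x = v3-cong (sym (◂-adjoint x M (col₁ N)))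
                    (sym (◂-adjoint x M (col₂ N)))
                    (sym (◂-adjoint x M (col₃ N)))

·-e₁ : ∀ M → M · e₁ ≡ col₁ M
·-e₁ M = v3-cong ⟨ row₁ M ,e₁⟩ ⟨ row₂ M ,e₁⟩ ⟨ row₃ M ,e₁⟩

·-e₂ : ∀ M → M · e₂ ≡ col₂ M
·-e₂ M = v3-cong ⟨ row₁ M ,e₂⟩ ⟨ row₂ M ,e₂⟩ ⟨ row₃ M ,e₂⟩

·-e₃ : ∀ M → M · e₃ ≡ col₃ M
·-e₃ M = v3-cong ⟨ row₁ M ,e₃⟩ ⟨ row₂ M ,e₃⟩ ⟨ row₃ M ,e₃⟩

e₁-◂ : ∀ M → e₁ ◂ M ≡ row₁ M
e₁-◂ M = v3-cong ⟨e₁, col₁ M ⟩ ⟨e₁, col₂ M ⟩ ⟨e₁, col₃ M ⟩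

e₂-◂ : ∀ M → e₂ ◂ M ≡ row₂ M
e₂-◂ M = v3-cong ⟨e₂, col₁ M ⟩ ⟨e₂, col₂ M ⟩ ⟨e₂, col₃ M ⟩

e₃-◂ : ∀ M → e₃ ◂ M ≡ row₃ M
e₃-◂ M = v3-cong ⟨e₃, col₁ M ⟩ ⟨e₃, col₂ M ⟩ ⟨e₃, col₃ M ⟩

-- J permutes coordinates: both its rows and its columns are e₃, e₂, e₁.
J-· : ∀ x → J · x ≡ v3 (x₃ x) (x₂ x) (x₁ x)
J-· x = v3-cong ⟨e₃, x ⟩ ⟨e₂, x ⟩ ⟨e₁, x ⟩

J-◂ : ∀ x → x ◂ J ≡ v3 (x₃ x) (x₂ x) (x₁ x)
J-◂ x = v3-cong ⟨ x ,e₃⟩ ⟨ x ,e₂⟩ ⟨ x ,e₁⟩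

LeftInvariant : {A : Set} → (V3 → A) → M3 → Set
LeftInvariant f M = ∀ x → f (M · x) ≡ f x

RightInvariant : {A : Set} → (V3 → A) → M3 → Set
RightInvariant f M = ∀ x → f (x ◂ M) ≡ f x

leftInvariant-⊗ : ∀ {A : Set} {f : V3 → A} {M N} →
  LeftInvariant f M → LeftInvariant f N → LeftInvariant f (M ⊗ N)
leftInvariant-⊗ {f = f} {M} {N} fM fN x =
  trans (cong f (·-⊗ M N x)) (trans (fM (N · x)) (fN x))

rightInvariant-⊗ : ∀ {A : Set} {f : V3 → A} {M N} →
  RightInvariant f M → RightInvariant f N → RightInvariant f (M ⊗ N)
rightInvariant-⊗ {f = f} {M} {N} fM fN x =
  trans (cong f (◂-⊗ M N x)) (trans (fN (x ◂ M)) (fM x))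

leftInvariant-inverse : ∀ {A : Set} {f : V3 → A} {M N} →
  LeftInvariant f M → M ⊗ N ≡ I₃ → LeftInvariant f N
leftInvariant-inverse {f = f} {M} {N} fM MN≡I x =
  trans (sym (fM (N · x)))
        (cong f (trans (sym (·-⊗ M N x)) (trans (cong (_· x) MN≡I) (·-identity x))))

rightInvariant-inverse : ∀ {A : Set} {f : V3 → A} {M N} →
  RightInvariant f M → N ⊗ M ≡ I₃ → RightInvariant f N
rightInvariant-inverse {f = f} {M} {N} fM NM≡I x =
  trans (sym (fM (x ◂ N)))
        (cong f (trans (sym (◂-⊗ N M x)) (trans (cong (x ◂_) NM≡I) (◂-identity x))))

H-leftInvariant : ∀ {A : Set} {f : V3 → A} →
  LeftInvariant f B → LeftInvariant f J → ∀ {M} → InH M → LeftInvariant f M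
H-leftInvariant {f = f} fB fJ h-id = λ x → cong f (·-identity x)
H-leftInvariant fB fJ h-B = fB
H-leftInvariant fB fJ h-J = fJ
H-leftInvariant fB fJ (h-mul {M} {N} hM hN) =
  leftInvariant-⊗ {M = M} {N} (H-leftInvariant fB fJ hM) (H-leftInvariant fB fJ hN)
H-leftInvariant fB fJ (h-inv {M} hM MN≡I _) =
  leftInvariant-inverse {M = M} (H-leftInvariant fB fJ hM) MN≡I

H-rightInvariant : ∀ {A : Set} {f : V3 → A} →
  RightInvariant f B → RightInvariant f J → ∀ {M} → InH M → RightInvariant f M
H-rightInvariant {f = f} fB fJ h-id = λ x → cong f (◂-identity x)
H-rightInvariant fB fJ h-B = fB
H-rightInvariant fB fJ h-J = fJ
H-rightInvariant fB fJ (h-mul {M} {N} hM hN) =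
  rightInvariant-⊗ {M = M} {N} (H-rightInvariant fB fJ hM) (H-rightInvariant fB fJ hN)
H-rightInvariant fB fJ (h-inv {M} hM _ NM≡I) =
  rightInvariant-inverse {M = M} (H-rightInvariant fB fJ hM) NM≡I

-- The two quadratic forms: InΓ a x is Q x ≡ a and InΩ a x is D x ≡ a.
Q D : V3 → ℤ
Q x = x₁ x * x₁ x - (+ 2) * (x₂ x * x₂ x) + x₃ x * x₃ x
D x = - ((+ 2) * (x₁ x * x₁ x)) + x₂ x * x₂ x - (+ 2) * (x₃ x * x₃ x)

-- B is an automorph of Q: (3a+4b)² − 2(2a+3b)² = a² − 2b².
Q-B : LeftInvariant Q B
Q-B (v3 a b c) = identity a b c
  where
  identity : ∀ a b c →
    (+ 3 * a + + 4 * b + + 0 * c) * (+ 3 * a + + 4 * b + + 0 * c)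
    - + 2 * ((+ 2 * a + + 3 * b + + 0 * c) * (+ 2 * a + + 3 * b + + 0 * c))
    + (+ 0 * a + + 0 * b + + 1 * c) * (+ 0 * a + + 0 * b + + 1 * c)
    ≡ a * a - + 2 * (b * b) + c * c
  identity = solve-∀

-- B is an automorph of D on the right: −2(3a+2b)² + (4a+3b)² = −2a² + b².
D-B : RightInvariant D B
D-B (v3 a b c) = identity a b c
  where
  identity : ∀ a b c →
    - (+ 2 * ((a * + 3 + b * + 2 + c * + 0) * (a * + 3 + b * + 2 + c * + 0)))
    + (a * + 4 + b * + 3 + c * + 0) * (a * + 4 + b * + 3 + c * + 0)
    - + 2 * ((a * + 0 + b * + 0 + c * + 1) * (a * + 0 + b * + 0 + c * + 1))
    ≡ - (+ 2 * (a * a)) + b * b - + 2 * (c * c)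
  identity = solve-∀

-- Q and D are symmetric in x₁ and x₃, and J swaps these coordinates.
Q-J : LeftInvariant Q J
Q-J x@(v3 a b c) = trans (cong Q (J-· x)) (identity a b c)
  where
  identity : ∀ a b c → c * c - + 2 * (b * b) + a * a ≡ a * a - + 2 * (b * b) + c * c
  identity = solve-∀

D-J : RightInvariant D J
D-J x@(v3 a b c) = trans (cong D (J-◂ x)) (identity a b c)
  where
  identity : ∀ a b c →
    - (+ 2 * (c * c)) + b * b - + 2 * (a * a) ≡ - (+ 2 * (a * a)) + b * b - + 2 * (c * c)
  identity = solve-∀

H-preserves-Q : ∀ {M} → InH M → LeftInvariant Q M
H-preserves-Q = H-leftInvariant Q-B Q-J

H-preserves-D : ∀ {M} → InH M → RightInvariant D M
H-preserves-D = H-rightInvariant D-B D-J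

Θ⊆Γ : ∀ {a} x → InΘ a x → InΓ a x
Θ⊆Γ _ (inj₁ (_ , x∈Γ , _)) = x∈Γ
Θ⊆Γ _ (inj₂ (_ , x∈Γ , _)) = x∈Γ

theorem1p1 :
    ((a : ℤ) → (∀ x → I₃ · x ≡ x)
             × (∀ M N x → (M ⊗ N) · x ≡ M · (N · x))
             × (∀ M x → InH M → InΓ a x → InΓ a (M · x)))
    × ((a : ℤ) → (∀ x → x ◂ I₃ ≡ x)
               × (∀ M N x → x ◂ (M ⊗ N) ≡ (x ◂ M) ◂ N)
               × (∀ M x → InH M → InΩ a x → InΩ a (x ◂ M)))
    × ((a : ℤ) → ∀ M x → InH M → InΘ a x → InΓ a (M · x))
    × (∀ M → InH M →
         (InΓ (+ 1) (col₁ M) × InΓ (- (+ 2)) (col₂ M) × InΓ (+ 1) (col₃ M))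
       × (InΩ (- (+ 2)) (row₁ M) × InΩ (+ 1) (row₂ M) × InΩ (- (+ 2)) (row₃ M)))
theorem1p1 =
    (λ a → ·-identity , ·-⊗ , λ M x h x∈Γ → trans (H-preserves-Q h x) x∈Γ)
  , (λ a → ◂-identity , ◂-⊗ , λ M x h x∈Ω → trans (H-preserves-D h x) x∈Ω)
  , (λ a M x h x∈Θ → trans (H-preserves-Q h x) (Θ⊆Γ x x∈Θ))
  , λ M h →
    -- Q e₁ = Q e₃ = 1, Q e₂ = −2, D e₁ = D e₃ = −2 and D e₂ = 1 by computation.
      ( Q-of-image h e₁ (·-e₁ M) , Q-of-image h e₂ (·-e₂ M) , Q-of-image h e₃ (·-e₃ M) )
    , ( D-of-image h e₁ (e₁-◂ M) , D-of-image h e₂ (e₂-◂ M) , D-of-image h e₃ (e₃-◂ M) )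
  where
  Q-of-image : ∀ {M} → InH M → ∀ v {w} → M · v ≡ w → Q w ≡ Q v
  Q-of-image h v Mv≡w = trans (cong Q (sym Mv≡w)) (H-preserves-Q h v)

  D-of-image : ∀ {M} → InH M → ∀ v {w} → v ◂ M ≡ w → D w ≡ D v
  D-of-image h v vM≡w = trans (cong D (sym vM≡w)) (H-preserves-D h v)
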